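{- Let $p \geq 4$ be an even integer and let $D$ be an oriented graph with at least $p + 2$ vertices. Then $\mathrm{inv}^{= p}(D) \leq (2p-2)(\mathrm{fas}(D) + 1)$.
   Context: For an oriented graph $D$ and $X\subseteq V(D)$, the inversion of $X$ reverses the orientation of every arc with both endpoints in $X$. A $(=p)$-inversion is the inversion of a set of exactly $p$ vertices. $\mathrm{inv}^{=p}(D)$ is the minimum number of $(=p)$-inversions whose successive application makes $D$ acyclic ($+\infty$ if impossible). $\mathrm{fas}(D)$ is the minimum size of a set of arcs whose deletion makes $D$ acyclic. -}

module Defs where

open import Data.Nat using (ℕ; zero; suc; _+_; _*_; _≤_)
open import Data.Bool using (Bool; true; false; _∧_; not; if_then_else_)
open import Data.Fin using (Fin)
open import Data.Fin.Subset using (Subset; ∣_∣)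
open import Data.Vec using (lookup)
open import Data.List using (List; []; _∷_; foldl; length; map; allFin)
open import Data.Nat.ListAction using (sum)
open import Data.Product using (Σ; ∃; _×_)
open import Relation.Binary.PropositionalEquality using (_≡_)
open import Relation.Nullary using (¬_)

Digraph : ℕ → Set
Digraph n = Fin n → Fin n → Bool

Arc : ∀ {n} → Digraph n → Fin n → Fin n → Set
Arc D u v = D u v ≡ true

-- Oriented graph: no loops and no pair of opposite arcs (no digons).
Oriented : ∀ {n} → Digraph n → Set
Oriented D = ∀ u v → Arc D u v → ¬ Arc D v u

data Walk {n} (D : Digraph n) : Fin n → Fin n → Set where
  [] : ∀ {x} → Walk D x x
  _∷_ : ∀ {x y z} → Arc D x y → Walk D y z → Walk D x z

HasCycle : ∀ {n} → Digraph n → Set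
HasCycle D = Σ _ λ v → Σ _ λ y → Arc D v y × Walk D y v

Acyclic : ∀ {n} → Digraph n → Set
Acyclic D = ¬ HasCycle D

invert : ∀ {n} → Subset n → Digraph n → Digraph n
invert X D u v = if lookup X u ∧ lookup X v then D v u else D u v

invertAll : ∀ {n} → List (Subset n) → Digraph n → Digraph n
invertAll Xs D = foldl (λ E X → invert X E) D Xs

data AllSize {n} (p : ℕ) : List (Subset n) → Set where
  [] : AllSize p []
  _∷_ : ∀ {X Xs} → ∣ X ∣ ≡ p → AllSize p Xs → AllSize p (X ∷ Xs)

InvEqLe : ∀ {n} → ℕ → Digraph n → ℕ → Set
InvEqLe p D k =
  Σ (List (Subset _)) λ Xs → AllSize p Xs × length Xs ≤ k × Acyclic (invertAll Xs D)

ArcSet : ℕ → Set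
ArcSet n = Fin n → Fin n → Bool

IsArcSetOf : ∀ {n} → ArcSet n → Digraph n → Set
IsArcSetOf F D = ∀ u v → F u v ≡ true → Arc D u v

size : ∀ {n} → ArcSet n → ℕ
size {n} F = sum (map (λ u → sum (map (λ v → if F u v then 1 else 0) (allFin n))) (allFin n))

delete : ∀ {n} → Digraph n → ArcSet n → Digraph n
delete D F u v = D u v ∧ not (F u v)

FeedbackArcSet : ∀ {n} → Digraph n → ArcSet n → Set
FeedbackArcSet D F = IsArcSetOf F D × Acyclic (delete D F)

IsFas : ∀ {n} → Digraph n → ℕ → Set
IsFas D k =
  (Σ _ λ F → FeedbackArcSet D F × size F ≡ k) ×
  (∀ F → FeedbackArcSet D F → k ≤ size F)

-- Inverting a set X reverses the arcs inside X, so a sequence of inversions reverses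
-- exactly the pairs of vertices lying in an odd number of its sets. Reversing the arcs
-- of a minimum feedback arc set F of D gives an acyclic digraph: by minimality each
-- reversed arc vu is bridged by a path from u to v in D − F. For even p, a set T of
-- p − 1 vertices avoiding u and v gives p − 1 (=p)-inversions reversing uv together
-- with all pairs inside T, so two such gadgets sharing T reverse just two pairs; routed
-- through an auxiliary pair, any two pairs are reversed by 4(p − 1) inversions. Pairing
-- up the arcs of F, plus, when |F| is odd, the pair of the first two sources of the
-- reversed digraph (whose reversal keeps it acyclic), gives (2p − 2)(|F| + 1) inversions.

module Submission where

open import Defs
open import Algebra.Bundles using (CommutativeRing; CommutativeMonoid)
import Algebra.Properties.CommutativeMonoid.Sum as CommutativeMonoidSum
import Algebra.Properties.CommutativeSemigroup as CommutativeSemigroupProperties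
open import Data.Bool using (Bool; true; false; _∧_; _∨_; not; _xor_; if_then_else_)
open import Data.Bool.Properties
  using (xor-∧-commutativeRing; ∧-identityʳ; ∧-zeroʳ; ∧-comm; ∧-assoc; ∨-identityʳ; ∨-zeroʳ; xor-identityʳ;
         xor-assoc; xor-comm; xor-same; not-involutive; ∧-distribˡ-xor; if-eta)
  renaming (_≟_ to _≟ᵇ_)
open import Data.Empty using (⊥; ⊥-elim)
open import Data.Unit using (⊤; tt)
open import Data.Nat using (ℕ; zero; suc; _+_; _*_; _∸_; _≤_; _<_; z≤n; s≤s; s≤s⁻¹)
open import Data.Nat.Properties
  using (+-0-commutativeMonoid; +-mono-≤; +-mono-<-≤; +-mono-≤-<; +-monoʳ-≤; +-identityʳ; +-comm; +-assoc; +-suc;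
         +-cancelʳ-≤; ≤-refl; ≤-trans; ≤-reflexive; <⇒≱; n<1+n; m≤m+n; m≤n+m; m∸n+n≡m; m+[n∸m]≡n;
         *-distribˡ-∸; *-suc; *-monoʳ-≤)
open import Data.Nat.Divisibility using (_∣_; divides)
open import Data.Nat.ListAction using (sum)
open import Data.Fin using (Fin; zero; suc; toℕ; fromℕ<)
open import Data.Fin.Properties using (_≟_; any?; pigeonhole)
open import Data.Fin.Subset using (Subset; ∣_∣)
open import Data.Vec using (lookup; tabulate)
open import Data.Vec.Properties using (lookup∘tabulate)
open import Data.List using (List; []; _∷_; _++_; length; foldr; map; allFin)
import Data.List as List
open import Data.List.Properties using (length-++; map-tabulate)
open import Data.List.Relation.Unary.All using (All; []; _∷_)
open import Data.List.Relation.Unary.All.Properties using (++⁺)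
open import Data.Product using (Σ; Σ-syntax; _×_; _,_; proj₁; proj₂; uncurry)
open import Data.Sum using (_⊎_; inj₁; inj₂)
open import Function using (_∘_; id)
open import Relation.Binary.PropositionalEquality
open import Relation.Nullary using (¬_; yes; no; Dec; does)
open import Relation.Nullary.Decidable using (dec-true; dec-false; _×-dec_; ¬?; decidable-stable)
open import Relation.Unary using (Decidable)

module ℕ-Sum = CommutativeMonoidSum +-0-commutativeMonoid
module ⊕-Sum = CommutativeMonoidSum (CommutativeRing.+-commutativeMonoid xor-∧-commutativeRing)

infix 4 _≡ᵇ_

_≡ᵇ_ : ∀ {n} → Fin n → Fin n → Bool
x ≡ᵇ y = does (x ≟ y)

≡ᵇ-refl : ∀ {n} (x : Fin n) → (x ≡ᵇ x) ≡ true
≡ᵇ-refl x = dec-true (x ≟ x) refl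

≢⇒≢ᵇ : ∀ {n} {x y : Fin n} → ¬ x ≡ y → (x ≡ᵇ y) ≡ false
≢⇒≢ᵇ {x = x} {y} = dec-false (x ≟ y)

∑ : ∀ {n} → (Fin n → ℕ) → ℕ
∑ = ℕ-Sum.sum

⨁ : ∀ {n} → (Fin n → Bool) → Bool
⨁ = ⊕-Sum.sum

𝟙 : Bool → ℕ
𝟙 b = if b then 1 else 0

count : ∀ {n} → (Fin n → Bool) → ℕ
count P = ∑ (𝟙 ∘ P)

∑-const-1 : ∀ n → ∑ {n} (λ _ → 1) ≡ n
∑-const-1 zero = refl
∑-const-1 (suc n) = cong suc (∑-const-1 n)

∑-mono-≤ : ∀ {n} {f g : Fin n → ℕ} → (∀ x → f x ≤ g x) → ∑ f ≤ ∑ g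
∑-mono-≤ {zero} f≤g = z≤n
∑-mono-≤ {suc n} f≤g = +-mono-≤ (f≤g zero) (∑-mono-≤ (f≤g ∘ suc))

∑-mono-< : ∀ {n} {f g : Fin n → ℕ} → (∀ x → f x ≤ g x) → (a : Fin n) → f a < g a → ∑ f < ∑ g
∑-mono-< {suc n} f≤g zero fa<ga = +-mono-<-≤ fa<ga (∑-mono-≤ (f≤g ∘ suc))
∑-mono-< {suc n} f≤g (suc a) fa<ga = +-mono-≤-< (f≤g zero) (∑-mono-< (f≤g ∘ suc) a fa<ga)

∑-zero : ∀ {n} {f : Fin n → ℕ} → (∀ x → f x ≡ 0) → ∑ f ≡ 0
∑-zero {n} f≡0 = trans (ℕ-Sum.sum-cong-≗ f≡0) (ℕ-Sum.sum-replicate-zero n)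

⨁-false : ∀ {n} {f : Fin n → Bool} → (∀ x → f x ≡ false) → ⨁ f ≡ false
⨁-false {n} f≡false = trans (⊕-Sum.sum-cong-≗ f≡false) (⊕-Sum.sum-replicate-zero n)

⨁-point : ∀ {n} (a : Fin n) (f : Fin n → Bool) → ⨁ (λ x → (x ≡ᵇ a) ∧ f x) ≡ f a
⨁-point {suc n} zero f = trans (cong (f zero xor_) (⨁-false {n} λ _ → refl)) (xor-identityʳ (f zero))
⨁-point (suc a) f = ⨁-point a (f ∘ suc)

count-point : ∀ {n} (a : Fin n) (f : Fin n → Bool) → ∑ (λ x → 𝟙 ((a ≡ᵇ x) ∧ f x)) ≡ 𝟙 (f a)
count-point {suc n} zero f = trans (cong (𝟙 (f zero) +_) (∑-zero {n} λ _ → refl)) (+-identityʳ _)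
count-point (suc a) f = count-point a (f ∘ suc)

count-singleton : ∀ {n} (a : Fin n) → count (a ≡ᵇ_) ≡ 1
count-singleton a = trans (ℕ-Sum.sum-cong-≗ λ x → cong 𝟙 (sym (∧-identityʳ (a ≡ᵇ x))))
                          (count-point a λ _ → true)

isOdd : ℕ → Bool
isOdd zero = false
isOdd (suc m) = not (isOdd m)

isOdd-𝟙+ : ∀ b m → isOdd (𝟙 b + m) ≡ b xor isOdd m
isOdd-𝟙+ true m = refl
isOdd-𝟙+ false m = refl

isOdd-double : ∀ k → isOdd (k * 2) ≡ false
isOdd-double zero = refl
isOdd-double (suc k) = trans (not-involutive _) (isOdd-double k)

isOdd-pred-even : ∀ {p} → 1 ≤ p → 2 ∣ p → isOdd (p ∸ 1) ≡ true
isOdd-pred-even {suc q} _ (divides k 1+q≡k*2) =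
  trans (sym (not-involutive (isOdd q))) (cong not (trans (cong isOdd 1+q≡k*2) (isOdd-double k)))

⨁≡isOdd-count : ∀ {n} (P : Fin n → Bool) → ⨁ P ≡ isOdd (count P)
⨁≡isOdd-count {zero} P = refl
⨁≡isOdd-count {suc n} P =
  trans (cong (P zero xor_) (⨁≡isOdd-count (P ∘ suc))) (sym (isOdd-𝟙+ (P zero) _))

𝟙-∨ : ∀ a b → 𝟙 (a ∨ b) ≤ 𝟙 a + 𝟙 b
𝟙-∨ true b = s≤s z≤n
𝟙-∨ false b = ≤-refl

𝟙-∨-disjoint : ∀ a b → a ∧ b ≡ false → 𝟙 (a ∨ b) ≡ 𝟙 a + 𝟙 b
𝟙-∨-disjoint true false _ = refl
𝟙-∨-disjoint false b _ = refl

𝟙-not : ∀ a → 𝟙 a + 𝟙 (not a) ≡ 1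
𝟙-not true = refl
𝟙-not false = refl

𝟙-split : ∀ a c → 𝟙 a ≡ 𝟙 (a ∧ not c) + 𝟙 (c ∧ a)
𝟙-split true true = refl
𝟙-split true false = refl
𝟙-split false true = refl
𝟙-split false false = refl

count-∨ : ∀ {n} (P Q : Fin n → Bool) → count (λ x → P x ∨ Q x) ≤ count P + count Q
count-∨ P Q =
  ≤-trans (∑-mono-≤ λ x → 𝟙-∨ (P x) (Q x)) (≤-reflexive (ℕ-Sum.∑-distrib-+ (𝟙 ∘ P) (𝟙 ∘ Q)))

count-∨-disjoint : ∀ {n} (P Q : Fin n → Bool) → (∀ x → P x ∧ Q x ≡ false) →
                   count (λ x → P x ∨ Q x) ≡ count P + count Q
count-∨-disjoint P Q disjoint =
  trans (ℕ-Sum.sum-cong-≗ λ x → 𝟙-∨-disjoint (P x) (Q x) (disjoint x))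
        (ℕ-Sum.∑-distrib-+ (𝟙 ∘ P) (𝟙 ∘ Q))

count-complement : ∀ {n} (P : Fin n → Bool) → count P + count (not ∘ P) ≡ n
count-complement {n} P = begin
  count P + count (not ∘ P)             ≡⟨ ℕ-Sum.∑-distrib-+ (𝟙 ∘ P) (𝟙 ∘ not ∘ P) ⟨
  ∑ (λ x → 𝟙 (P x) + 𝟙 (not (P x)))   ≡⟨ ℕ-Sum.sum-cong-≗ (𝟙-not ∘ P) ⟩
  ∑ {n} (λ _ → 1)                       ≡⟨ ∑-const-1 n ⟩
  n                                     ∎
  where open ≡-Reasoning

count-remove : ∀ {n} (T : Fin n → Bool) {a} → T a ≡ true →
               suc (count (λ x → T x ∧ not (a ≡ᵇ x))) ≡ count T
count-remove T {a} Ta = sym (begin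
  count T                          ≡⟨ ℕ-Sum.sum-cong-≗ (λ x → 𝟙-split (T x) (a ≡ᵇ x)) ⟩
  ∑ (λ x → 𝟙 (T−a x) + 𝟙 (T∩a x)) ≡⟨ ℕ-Sum.∑-distrib-+ (𝟙 ∘ T−a) (𝟙 ∘ T∩a) ⟩
  count T−a + count T∩a            ≡⟨ cong (count T−a +_) (trans (count-point a T) (cong 𝟙 Ta)) ⟩
  count T−a + 1                    ≡⟨ +-comm (count T−a) 1 ⟩
  suc (count T−a)                  ∎)
  where
    open ≡-Reasoning
    T−a T∩a : Fin _ → Bool
    T−a x = T x ∧ not (a ≡ᵇ x)
    T∩a x = (a ≡ᵇ x) ∧ T x

∣tabulate∣ : ∀ {n} (P : Fin n → Bool) → ∣ tabulate P ∣ ≡ count P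
∣tabulate∣ {zero} P = refl
∣tabulate∣ {suc n} P with P zero
... | true = cong suc (∣tabulate∣ (P ∘ suc))
... | false = ∣tabulate∣ (P ∘ suc)

BoolRel : ℕ → Set
BoolRel n = Fin n → Fin n → Bool

infixl 6 _⊕_
infix 4 _≐_

_⊕_ : ∀ {n} → BoolRel n → BoolRel n → BoolRel n
(φ ⊕ ψ) i j = φ i j xor ψ i j

_ᵀ : ∀ {n} → BoolRel n → BoolRel n
(φ ᵀ) i j = φ j i

-- reverseOn never changes a loop, so relations need only agree off the diagonal.
_≐_ : ∀ {n} → BoolRel n → BoolRel n → Set
φ ≐ ψ = ∀ i j → ¬ i ≡ j → φ i j ≡ ψ i j

clique : ∀ {n} → (Fin n → Bool) → BoolRel n
clique P i j = P i ∧ P j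

reverseOn : ∀ {n} → BoolRel n → Digraph n → Digraph n
reverseOn φ D u v = if φ u v then D v u else D u v

reverseOn-⊕ : ∀ {n} {φ ψ : BoolRel n} {D : Digraph n} → (∀ u v → φ v u ≡ φ u v) →
              ∀ u v → reverseOn ψ (reverseOn φ D) u v ≡ reverseOn (φ ⊕ ψ) D u v
reverseOn-⊕ {φ = φ} {ψ} φ-sym u v rewrite φ-sym u v with φ u v | ψ u v
... | true  | true  = refl
... | true  | false = refl
... | false | true  = refl
... | false | false = refl

reverseOn-cong : ∀ {n} {φ ψ : BoolRel n} {D : Digraph n} → φ ≐ ψ →
                 ∀ u v → reverseOn φ D u v ≡ reverseOn ψ D u v
reverseOn-cong {φ = φ} {ψ} {D} φ≐ψ u v with u ≟ v
... | yes refl = trans (if-eta (φ u u)) (sym (if-eta (ψ u u)))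
... | no u≢v = cong (if_then D v u else D u v) (φ≐ψ u v u≢v)

walk-map : ∀ {n} {G H : Digraph n} → (∀ x y → Arc G x y → Arc H x y) →
           ∀ {a b} → Walk G a b → Walk H a b
walk-map G⊆H [] = []
walk-map G⊆H (e ∷ w) = G⊆H _ _ e ∷ walk-map G⊆H w

acyclic-⊆ : ∀ {n} {G H : Digraph n} → (∀ x y → Arc G x y → Arc H x y) → Acyclic H → Acyclic G
acyclic-⊆ G⊆H acyclic (v , y , e , w) = acyclic (v , y , G⊆H _ _ e , walk-map G⊆H w)

acyclic-≗ : ∀ {n} {G H : Digraph n} → (∀ x y → G x y ≡ H x y) → Acyclic H → Acyclic G
acyclic-≗ G≗H = acyclic-⊆ λ x y e → trans (sym (G≗H x y)) e

parity : ∀ {A : Set} → (A → Bool) → List A → Bool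
parity h = foldr (λ a b → h a xor b) false

parity-++ : ∀ {A : Set} (h : A → Bool) (xs ys : List A) →
            parity h (xs ++ ys) ≡ parity h xs xor parity h ys
parity-++ h [] ys = refl
parity-++ h (x ∷ xs) ys =
  trans (cong (h x xor_) (parity-++ h xs ys)) (sym (xor-assoc (h x) _ _))

crossings : ∀ {n} → List (Subset n) → BoolRel n
crossings Xs i j = parity (λ X → clique (lookup X) i j) Xs

invertAll≡reverseOn-crossings : ∀ {n} (Xs : List (Subset n)) (D : Digraph n) u v →
                                invertAll Xs D u v ≡ reverseOn (crossings Xs) D u v
invertAll≡reverseOn-crossings [] D u v = refl
invertAll≡reverseOn-crossings (X ∷ Xs) D u v =
  trans (invertAll≡reverseOn-crossings Xs (invert X D) u v)
        (reverseOn-⊕ {φ = clique (lookup X)} {crossings Xs} {D}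
                     (λ u v → ∧-comm (lookup X v) (lookup X u)) u v)

record Realises {n} (p k : ℕ) (φ : BoolRel n) : Set where
  field
    sets : List (Subset n)
    sized : All (λ X → ∣ X ∣ ≡ p) sets
    few : length sets ≤ k
    effect : crossings sets ≐ φ

Realises-[] : ∀ {n p} → Realises {n} p 0 (λ _ _ → false)
Realises-[] = record { sets = [] ; sized = [] ; few = ≤-refl ; effect = λ _ _ _ → refl }

Realises-++ : ∀ {n p k l} {φ ψ : BoolRel n} → Realises p k φ → Realises p l ψ → Realises p (k + l) (φ ⊕ ψ)
Realises-++ r s = record
  { sets = R.sets ++ S.sets
  ; sized = ++⁺ R.sized S.sized
  ; few = ≤-trans (≤-reflexive (length-++ R.sets)) (+-mono-≤ R.few S.few)
  ; effect = λ i j i≢j → trans (parity-++ (λ X → clique (lookup X) i j) R.sets S.sets)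
                                (cong₂ _xor_ (R.effect i j i≢j) (S.effect i j i≢j))
  }
  where module R = Realises r
        module S = Realises s

Realises-cong : ∀ {n p k} {φ ψ : BoolRel n} → φ ≐ ψ → Realises p k φ → Realises p k ψ
Realises-cong φ≐ψ r = record
  { Realises r ; effect = λ i j i≢j → trans (Realises.effect r i j i≢j) (φ≐ψ i j i≢j) }

Realises-weaken : ∀ {n p k l} {φ : BoolRel n} → k ≤ l → Realises p k φ → Realises p l φ
Realises-weaken k≤l r = record { Realises r ; few = ≤-trans (Realises.few r) k≤l }

All⇒AllSize : ∀ {n p} {Xs : List (Subset n)} → All (λ X → ∣ X ∣ ≡ p) Xs → AllSize p Xs
All⇒AllSize [] = []
All⇒AllSize (e ∷ es) = e ∷ All⇒AllSize es

Realises⇒InvEqLe : ∀ {n p k} {φ : BoolRel n} {D : Digraph n} →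
                   Realises p k φ → Acyclic (reverseOn φ D) → InvEqLe p D k
Realises⇒InvEqLe {D = D} r acyclic =
  sets , All⇒AllSize sized , few ,
  acyclic-≗ (λ u v → trans (invertAll≡reverseOn-crossings sets D u v) (reverseOn-cong {D = D} effect u v))
            acyclic
  where open Realises r

collect : ∀ {A : Set} {m} → (Fin m → Bool) → (Fin m → A) → List A
collect {m = zero} B e = []
collect {m = suc m} B e with B zero
... | true = e zero ∷ collect (B ∘ suc) (e ∘ suc)
... | false = collect (B ∘ suc) (e ∘ suc)

length-collect : ∀ {A : Set} {m} (B : Fin m → Bool) (e : Fin m → A) → length (collect B e) ≡ count B
length-collect {m = zero} B e = refl
length-collect {m = suc m} B e with B zero
... | true = cong suc (length-collect (B ∘ suc) (e ∘ suc))
... | false = length-collect (B ∘ suc) (e ∘ suc)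

parity-collect : ∀ {A : Set} {m} (h : A → Bool) (B : Fin m → Bool) (e : Fin m → A) →
                 parity h (collect B e) ≡ ⨁ (λ x → B x ∧ h (e x))
parity-collect {m = zero} h B e = refl
parity-collect {m = suc m} h B e with B zero
... | true = cong (h (e zero) xor_) (parity-collect h (B ∘ suc) (e ∘ suc))
... | false = parity-collect h (B ∘ suc) (e ∘ suc)

All-collect : ∀ {A : Set} {P : A → Set} {m} (B : Fin m → Bool) (e : Fin m → A) →
              (∀ x → B x ≡ true → P (e x)) → All P (collect B e)
All-collect {m = zero} B e Pe = []
All-collect {m = suc m} B e Pe with B zero in Bz
... | true = Pe zero Bz ∷ All-collect (B ∘ suc) (e ∘ suc) (Pe ∘ suc)
... | false = All-collect (B ∘ suc) (e ∘ suc) (Pe ∘ suc)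

⁅_,_⁆ : ∀ {n} → Fin n → Fin n → Fin n → Bool
⁅ u , v ⁆ x = (u ≡ᵇ x) ∨ (v ≡ᵇ x)

pairRel : ∀ {n} → Fin n → Fin n → BoolRel n
pairRel u v = clique ⁅ u , v ⁆

≡ᵇ-disjointʳ : ∀ {n} {u v : Fin n} → ¬ u ≡ v → ∀ x → (u ≡ᵇ x) ∧ (v ≡ᵇ x) ≡ false
≡ᵇ-disjointʳ {u = u} {v} u≢v x with u ≟ x | v ≟ x
... | yes refl | yes refl = ⊥-elim (u≢v refl)
... | yes refl | no _ = refl
... | no u≢x | _ = refl

≡ᵇ-disjointˡ : ∀ {n} {i j : Fin n} → ¬ i ≡ j → ∀ u → (u ≡ᵇ i) ∧ (u ≡ᵇ j) ≡ false
≡ᵇ-disjointˡ {i = i} {j} i≢j u with u ≟ i | u ≟ j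
... | yes refl | yes refl = ⊥-elim (i≢j refl)
... | yes refl | no _ = refl
... | no _ | _ = refl

count-pair : ∀ {n} {u v : Fin n} → ¬ u ≡ v → count ⁅ u , v ⁆ ≡ 2
count-pair {u = u} {v} u≢v =
  trans (count-∨-disjoint (u ≡ᵇ_) (v ≡ᵇ_) (≡ᵇ-disjointʳ u≢v))
        (cong₂ _+_ (count-singleton u) (count-singleton v))

avoids-pair : ∀ {n} {u v : Fin n} {T : Fin n → Bool} → T u ≡ false → T v ≡ false →
              ∀ x → ⁅ u , v ⁆ x ∧ T x ≡ false
avoids-pair {u = u} {v} Tu Tv x with u ≟ x | v ≟ x
... | yes refl | _ = Tu
... | no _ | yes refl = Tv
... | no _ | no _ = refl

∧-not-as-xor : ∀ a c → a ∧ not c ≡ a xor (c ∧ a)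
∧-not-as-xor true true = refl
∧-not-as-xor true false = refl
∧-not-as-xor false true = refl
∧-not-as-xor false false = refl

⨁-remove : ∀ {n} (T : Fin n → Bool) (a : Fin n) → ⨁ (λ x → T x ∧ not (x ≡ᵇ a)) ≡ ⨁ T xor T a
⨁-remove T a =
  trans (⊕-Sum.sum-cong-≗ λ x → ∧-not-as-xor (T x) (x ≡ᵇ a))
        (trans (⊕-Sum.∑-distrib-+ T (λ x → (x ≡ᵇ a) ∧ T x)) (cong (⨁ T xor_) (⨁-point a T)))

-- a, b record whether i, j lie in the pair, s, t whether they lie in T; the four
-- sums are the parities of T, T − i, T − j and T − i − j.
gadget-table : ∀ {m} (T e₁ e₂ : Fin m → Bool) (a b s t : Bool) →
  ⨁ T ≡ true →
  ⨁ (λ x → T x ∧ not (e₁ x)) ≡ true xor s →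
  ⨁ (λ x → T x ∧ not (e₂ x)) ≡ true xor t →
  ⨁ (λ x → (T x ∧ not (e₁ x)) ∧ not (e₂ x)) ≡ (true xor s) xor t →
  a ∧ s ≡ false → b ∧ t ≡ false →
  ⨁ (λ x → T x ∧ ((a ∨ (s ∧ not (e₁ x))) ∧ (b ∨ (t ∧ not (e₂ x))))) ≡ (a ∧ b) xor (s ∧ t)
gadget-table T e₁ e₂ true  true  false false h h₁ h₂ h₁₂ _ _ = trans (⊕-Sum.sum-cong-≗ (∧-identityʳ ∘ T)) h
gadget-table T e₁ e₂ true  false false true  h h₁ h₂ h₁₂ _ _ = h₂
gadget-table T e₁ e₂ true  false false false h h₁ h₂ h₁₂ _ _ = ⨁-false (∧-zeroʳ ∘ T)
gadget-table T e₁ e₂ false true  true  false h h₁ h₂ h₁₂ _ _ =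
  trans (⊕-Sum.sum-cong-≗ λ x → cong (T x ∧_) (∧-identityʳ (not (e₁ x)))) h₁
gadget-table T e₁ e₂ false true  false false h h₁ h₂ h₁₂ _ _ = ⨁-false (∧-zeroʳ ∘ T)
gadget-table T e₁ e₂ false false true  true  h h₁ h₂ h₁₂ _ _ =
  trans (⊕-Sum.sum-cong-≗ λ x → sym (∧-assoc (T x) _ _)) h₁₂
gadget-table T e₁ e₂ false false true  false h h₁ h₂ h₁₂ _ _ =
  ⨁-false λ x → trans (cong (T x ∧_) (∧-zeroʳ (not (e₁ x)))) (∧-zeroʳ (T x))
gadget-table T e₁ e₂ false false false true  h h₁ h₂ h₁₂ _ _ = ⨁-false (∧-zeroʳ ∘ T)
gadget-table T e₁ e₂ false false false false h h₁ h₂ h₁₂ _ _ = ⨁-false (∧-zeroʳ ∘ T)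
gadget-table T e₁ e₂ true  _     true  _     h h₁ h₂ h₁₂ () _
gadget-table T e₁ e₂ _     true  _     true  h h₁ h₂ h₁₂ _ ()

module Gadget {n} (u v : Fin n) (T : Fin n → Bool) where

  member : Fin n → Fin n → Bool
  member x y = ⁅ u , v ⁆ y ∨ (T y ∧ not (x ≡ᵇ y))

  sets : List (Subset n)
  sets = collect T (λ x → tabulate (member x))

  module _ (u≢v : ¬ u ≡ v) (Tu : T u ≡ false) (Tv : T v ≡ false) where

    count-member : ∀ {x} → T x ≡ true → count (member x) ≡ suc (count T)
    count-member {x} Tx = begin
      count (member x)            ≡⟨ count-∨-disjoint ⁅ u , v ⁆ T−x disjoint ⟩
      count ⁅ u , v ⁆ + count T−x ≡⟨ cong (_+ count T−x) (count-pair u≢v) ⟩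
      2 + count T−x               ≡⟨ cong suc (count-remove T Tx) ⟩
      suc (count T)               ∎
      where
        open ≡-Reasoning
        T−x : Fin n → Bool
        T−x y = T y ∧ not (x ≡ᵇ y)
        disjoint : ∀ y → ⁅ u , v ⁆ y ∧ T−x y ≡ false
        disjoint y = trans (sym (∧-assoc (⁅ u , v ⁆ y) (T y) (not (x ≡ᵇ y))))
                           (cong (_∧ not (x ≡ᵇ y)) (avoids-pair {T = T} Tu Tv y))

    effect : isOdd (count T) ≡ true → crossings sets ≐ pairRel u v ⊕ clique T
    effect odd i j i≢j = begin
      crossings sets i j
        ≡⟨ parity-collect (λ X → clique (lookup X) i j) T (λ x → tabulate (member x)) ⟩
      ⨁ (λ x → T x ∧ clique (lookup (tabulate (member x))) i j)
        ≡⟨ ⊕-Sum.sum-cong-≗ (λ x → cong₂ (λ a b → T x ∧ (a ∧ b))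
                                          (lookup∘tabulate (member x) i) (lookup∘tabulate (member x) j)) ⟩
      ⨁ (λ x → T x ∧ (member x i ∧ member x j))
        ≡⟨ gadget-table T (_≡ᵇ i) (_≡ᵇ j) (⁅ u , v ⁆ i) (⁅ u , v ⁆ j) (T i) (T j) ⨁T ⨁T−i ⨁T−j ⨁T−i−j
                        (avoids-pair {T = T} Tu Tv i) (avoids-pair {T = T} Tu Tv j) ⟩
      (pairRel u v ⊕ clique T) i j ∎
      where
        open ≡-Reasoning
        ⨁T : ⨁ T ≡ true
        ⨁T = trans (⨁≡isOdd-count T) odd
        ⨁T−i : ⨁ (λ x → T x ∧ not (x ≡ᵇ i)) ≡ true xor T i
        ⨁T−i = trans (⨁-remove T i) (cong (_xor T i) ⨁T)
        ⨁T−j : ⨁ (λ x → T x ∧ not (x ≡ᵇ j)) ≡ true xor T j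
        ⨁T−j = trans (⨁-remove T j) (cong (_xor T j) ⨁T)
        ⨁T−i−j : ⨁ (λ x → (T x ∧ not (x ≡ᵇ i)) ∧ not (x ≡ᵇ j)) ≡ (true xor T i) xor T j
        ⨁T−i−j = trans (⨁-remove (λ x → T x ∧ not (x ≡ᵇ i)) j)
                       (cong₂ _xor_ ⨁T−i (trans (cong (λ c → T j ∧ not c) (≢⇒≢ᵇ (i≢j ∘ sym)))
                                                (∧-identityʳ (T j))))

-- The sets {u, v} ∪ (T − x), x ∈ T, contain uv |T| times, a pair inside T |T| − 2 times,
-- and a pair between {u, v} and T |T| − 1 times; for |T| odd only the last count is even.
gadget : ∀ {n} {u v : Fin n} {T : Fin n → Bool} → ¬ u ≡ v → T u ≡ false → T v ≡ false →
         isOdd (count T) ≡ true → Realises (suc (count T)) (count T) (pairRel u v ⊕ clique T)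
gadget {u = u} {v} {T} u≢v Tu Tv odd = record
  { sets = G.sets
  ; sized = All-collect T _ λ x Tx → trans (∣tabulate∣ (G.member x)) (G.count-member u≢v Tu Tv Tx)
  ; few = ≤-reflexive (length-collect T _)
  ; effect = G.effect u≢v Tu Tv odd
  }
  where module G = Gadget u v T

firstOf : ∀ {n} → ℕ → (Fin n → Bool) → Fin n → Bool
firstOf zero Q x = false
firstOf (suc k) Q zero = Q zero
firstOf (suc k) Q (suc x) = firstOf (if Q zero then k else suc k) (Q ∘ suc) x

firstOf⊆ : ∀ {n} k (Q : Fin n → Bool) x → firstOf k Q x ≡ true → Q x ≡ true
firstOf⊆ (suc k) Q zero e = e
firstOf⊆ (suc k) Q (suc x) e = firstOf⊆ (if Q zero then k else suc k) (Q ∘ suc) x e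

count-firstOf : ∀ {n} k (Q : Fin n → Bool) → k ≤ count Q → count (firstOf k Q) ≡ k
count-firstOf {n} zero Q _ = ∑-zero {n} λ _ → refl
count-firstOf {suc n} (suc k) Q k<c with Q zero
... | true = cong suc (count-firstOf k (Q ∘ suc) (s≤s⁻¹ k<c))
... | false = count-firstOf (suc k) (Q ∘ suc) k<c

padding : ∀ {n} m (A : Fin n → Bool) → m + count A ≤ n →
          Σ[ T ∈ (Fin n → Bool) ] count T ≡ m × (∀ x → A x ≡ true → T x ≡ false)
padding m A room = firstOf m (not ∘ A) , count-firstOf m (not ∘ A) m≤ , avoids
  where
    m≤ : m ≤ count (not ∘ A)
    m≤ = +-cancelʳ-≤ (count A) m (count (not ∘ A))
           (≤-trans room (≤-reflexive (trans (sym (count-complement A)) (+-comm (count A) _))))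
    avoids : ∀ x → A x ≡ true → firstOf m (not ∘ A) x ≡ false
    avoids x Ax with firstOf m (not ∘ A) x in e
    ... | false = refl
    ... | true with trans (sym (cong not Ax)) (firstOf⊆ m (not ∘ A) x e)
    ...   | ()

count-triple : ∀ {n} (a b c : Fin n) → count (λ x → (a ≡ᵇ x) ∨ ((b ≡ᵇ x) ∨ (c ≡ᵇ x))) ≤ 3
count-triple a b c =
  ≤-trans (count-∨ (a ≡ᵇ_) _)
          (+-mono-≤ (≤-reflexive (count-singleton a))
                    (≤-trans (count-∨ (b ≡ᵇ_) (c ≡ᵇ_))
                             (≤-reflexive (cong₂ _+_ (count-singleton b) (count-singleton c)))))

module ⊕-Semigroup = CommutativeSemigroupProperties
  (CommutativeMonoid.commutativeSemigroup (CommutativeRing.+-commutativeMonoid xor-∧-commutativeRing))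

xor-cancelʳ : ∀ a b t → (a xor t) xor (b xor t) ≡ a xor b
xor-cancelʳ a b t =
  trans (⊕-Semigroup.interchange a t b t) (trans (cong ((a xor b) xor_) (xor-same t)) (xor-identityʳ (a xor b)))

double-pred : ∀ p → (p ∸ 1) + (p ∸ 1) ≡ 2 * p ∸ 2
double-pred p = trans (cong ((p ∸ 1) +_) (sym (+-identityʳ (p ∸ 1)))) (*-distribˡ-∸ 2 p 1)

hub : ∀ {n} {u₁ u₂ : Fin n} → ¬ u₁ ≡ u₂ → (v₁ : Fin n) →
      Σ[ r ∈ Fin n ] ¬ u₁ ≡ r × (v₁ ≡ u₁ ⊎ v₁ ≡ r)
hub {u₁ = u₁} {u₂} u₁≢u₂ v₁ with u₁ ≟ v₁
... | yes u₁≡v₁ = u₂ , u₁≢u₂ , inj₁ (sym u₁≡v₁)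
... | no u₁≢v₁ = v₁ , u₁≢v₁ , inj₂ refl

avoids-either : ∀ {n} {T : Fin n → Bool} {v a b} → v ≡ a ⊎ v ≡ b →
                T a ≡ false → T b ≡ false → T v ≡ false
avoids-either (inj₁ refl) Ta Tb = Ta
avoids-either (inj₂ refl) Ta Tb = Tb

flips : ∀ {n} → List (Fin n × Fin n) → BoolRel n
flips ps i j = parity (λ e → uncurry pairRel e i j) ps

data EvenLength {A : Set} : List A → Set where
  [] : EvenLength []
  cons₂ : ∀ {x y l} → EvenLength l → EvenLength (x ∷ y ∷ l)

even-or-snoc : ∀ {A : Set} (l : List A) (z : A) → EvenLength l ⊎ EvenLength (l ++ z ∷ [])
even-or-snoc [] z = inj₁ []
even-or-snoc (x ∷ []) z = inj₂ (cons₂ [])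
even-or-snoc (x ∷ y ∷ l) z with even-or-snoc l z
... | inj₁ e = inj₁ (cons₂ e)
... | inj₂ e = inj₂ (cons₂ e)

module PairReversal {n p : ℕ} (1≤p : 1 ≤ p) (p-even : 2 ∣ p) (room : p + 2 ≤ n) where

  triple : Fin n → Fin n → Fin n → Fin n → Bool
  triple a b c x = (a ≡ᵇ x) ∨ ((b ≡ᵇ x) ∨ (c ≡ᵇ x))

  room-for-padding : ∀ a b c → (p ∸ 1) + count (triple a b c) ≤ n
  room-for-padding a b c =
    ≤-trans (+-monoʳ-≤ (p ∸ 1) (count-triple a b c))
            (≤-trans (≤-reflexive (trans (+-suc (p ∸ 1) 2) (cong (_+ 2) (m+[n∸m]≡n 1≤p)))) room)

  padding-avoiding : (a b c : Fin n) →
             Σ[ T ∈ (Fin n → Bool) ] count T ≡ p ∸ 1 × T a ≡ false × T b ≡ false × T c ≡ false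
  padding-avoiding a b c with padding (p ∸ 1) (triple a b c) (room-for-padding a b c)
  ... | T , |T| , avoids =
    T , |T| , avoids a (cong (_∨ ((b ≡ᵇ a) ∨ (c ≡ᵇ a))) (≡ᵇ-refl a)) ,
    avoids b (trans (cong (λ t → (a ≡ᵇ b) ∨ (t ∨ (c ≡ᵇ b))) (≡ᵇ-refl b)) (∨-zeroʳ (a ≡ᵇ b))) ,
    avoids c (trans (cong (λ t → (a ≡ᵇ c) ∨ ((b ≡ᵇ c) ∨ t)) (≡ᵇ-refl c))
                    (trans (cong ((a ≡ᵇ c) ∨_) (∨-zeroʳ (b ≡ᵇ c))) (∨-zeroʳ (a ≡ᵇ c))))

  p-gadget : ∀ {u v : Fin n} {T} → ¬ u ≡ v → T u ≡ false → T v ≡ false → count T ≡ p ∸ 1 →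
            Realises p (p ∸ 1) (pairRel u v ⊕ clique T)
  p-gadget {u} {v} {T} u≢v Tu Tv |T| =
    subst₂ (λ q k → Realises q k (pairRel u v ⊕ clique T)) (trans (cong suc |T|) (m+[n∸m]≡n 1≤p)) |T|
           (gadget u≢v Tu Tv (trans (cong isOdd |T|) (isOdd-pred-even 1≤p p-even)))

  two-gadgets : ∀ {u v u′ v′ : Fin n} {T} → ¬ u ≡ v → ¬ u′ ≡ v′ → count T ≡ p ∸ 1 →
                T u ≡ false → T v ≡ false → T u′ ≡ false → T v′ ≡ false →
                Realises p (2 * p ∸ 2) (pairRel u v ⊕ pairRel u′ v′)
  two-gadgets {u} {v} {u′} {v′} {T} u≢v u′≢v′ |T| Tu Tv Tu′ Tv′ =
    Realises-weaken (≤-reflexive (double-pred p))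
      (Realises-cong (λ i j _ → xor-cancelʳ (pairRel u v i j) (pairRel u′ v′ i j) (clique T i j))
        (Realises-++ (p-gadget u≢v Tu Tv |T|) (p-gadget u′≢v′ Tu′ Tv′ |T|)))

  -- A padding avoiding all four endpoints need not exist when n = p + 2, so both pairs
  -- are traded against a pair u₁r meeting each of them.
  two-pairs : ∀ {u₁ u₂ v₁ v₂ : Fin n} → ¬ u₁ ≡ u₂ → ¬ v₁ ≡ v₂ →
              Realises p ((2 * p ∸ 2) + (2 * p ∸ 2)) (pairRel u₁ u₂ ⊕ pairRel v₁ v₂)
  two-pairs {u₁} {u₂} {v₁} {v₂} u₁≢u₂ v₁≢v₂ with hub u₁≢u₂ v₁
  ... | r , u₁≢r , v₁∈u₁r with padding-avoiding u₁ u₂ r | padding-avoiding u₁ r v₂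
  ... | T , |T| , Tu₁ , Tu₂ , Tr | T′ , |T′| , T′u₁ , T′r , T′v₂ =
    Realises-cong (λ i j _ → xor-cancelʳ (pairRel u₁ u₂ i j) (pairRel v₁ v₂ i j) (pairRel u₁ r i j))
      (Realises-++ (two-gadgets u₁≢u₂ u₁≢r |T| Tu₁ Tu₂ Tu₁ Tr)
                   (two-gadgets v₁≢v₂ u₁≢r |T′| (avoids-either v₁∈u₁r T′u₁ T′r) T′v₂ T′u₁ T′r))

  even-pairs : ∀ {ps : List (Fin n × Fin n)} → All (uncurry _≢_) ps → EvenLength ps →
               Realises p ((2 * p ∸ 2) * length ps) (flips ps)
  even-pairs [] [] = Realises-weaken z≤n Realises-[]
  even-pairs {(u₁ , u₂) ∷ (v₁ , v₂) ∷ ps} (u₁≢u₂ ∷ v₁≢v₂ ∷ proper) (cons₂ even) =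
    Realises-weaken (≤-reflexive bound)
      (Realises-cong (λ i j _ → xor-assoc (pairRel u₁ u₂ i j) (pairRel v₁ v₂ i j) (flips ps i j))
        (Realises-++ (two-pairs u₁≢u₂ v₁≢v₂) (even-pairs proper even)))
    where
      c = 2 * p ∸ 2
      bound : (c + c) + c * length ps ≡ c * suc (suc (length ps))
      bound = trans (+-assoc c c _) (sym (trans (*-suc c (suc (length ps))) (cong (c +_) (*-suc c (length ps)))))

  even-pairs-with-spare : ∀ {ps : List (Fin n × Fin n)} {s : Fin n × Fin n} →
                          All (uncurry _≢_) ps → uncurry _≢_ s →
                          Realises p ((2 * p ∸ 2) * (length ps + 1)) (flips ps) ⊎
                          Realises p ((2 * p ∸ 2) * (length ps + 1)) (flips ps ⊕ uncurry pairRel s)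
  even-pairs-with-spare {ps} {s} proper s-proper with even-or-snoc ps s
  ... | inj₁ even = inj₁ (Realises-weaken (*-monoʳ-≤ (2 * p ∸ 2) (m≤m+n (length ps) 1)) (even-pairs proper even))
  ... | inj₂ even =
    inj₂ (subst (λ l → Realises p ((2 * p ∸ 2) * l) (flips ps ⊕ uncurry pairRel s)) (length-++ ps)
                (Realises-cong snoc (even-pairs (++⁺ proper (s-proper ∷ [])) even)))
    where
      snoc : flips (ps ++ s ∷ []) ≐ flips ps ⊕ uncurry pairRel s
      snoc i j _ = trans (parity-++ (λ e → uncurry pairRel e i j) ps (s ∷ []))
                         (cong (flips ps i j xor_) (xor-identityʳ (uncurry pairRel s i j)))

flatten : ∀ {A : Set} {m} → (Fin m → List A) → List A
flatten {m = zero} g = []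
flatten {m = suc m} g = g zero ++ flatten (g ∘ suc)

length-flatten : ∀ {A : Set} {m} (g : Fin m → List A) → length (flatten g) ≡ ∑ (length ∘ g)
length-flatten {m = zero} g = refl
length-flatten {m = suc m} g = trans (length-++ (g zero)) (cong (length (g zero) +_) (length-flatten (g ∘ suc)))

parity-flatten : ∀ {A : Set} {m} (h : A → Bool) (g : Fin m → List A) →
                 parity h (flatten g) ≡ ⨁ (parity h ∘ g)
parity-flatten {m = zero} h g = refl
parity-flatten {m = suc m} h g =
  trans (parity-++ h (g zero) _) (cong (parity h (g zero) xor_) (parity-flatten h (g ∘ suc)))

All-flatten : ∀ {A : Set} {P : A → Set} {m} (g : Fin m → List A) → (∀ x → All P (g x)) → All P (flatten g)
All-flatten {m = zero} g Pg = []
All-flatten {m = suc m} g Pg = ++⁺ (Pg zero) (All-flatten (g ∘ suc) (Pg ∘ suc))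

arcs : ∀ {n} → ArcSet n → List (Fin n × Fin n)
arcs F = flatten λ u → collect (F u) (u ,_)

sum-allFin : ∀ {n} (f : Fin n → ℕ) → sum (map f (allFin n)) ≡ ∑ f
sum-allFin f = trans (cong sum (map-tabulate id f)) (sum-tabulate f)
  where
    sum-tabulate : ∀ {n} (f : Fin n → ℕ) → sum (List.tabulate f) ≡ ∑ f
    sum-tabulate {zero} f = refl
    sum-tabulate {suc n} f = cong (f zero +_) (sum-tabulate (f ∘ suc))

size≡∑count : ∀ {n} (F : ArcSet n) → size F ≡ ∑ (λ u → count (F u))
size≡∑count {n} F =
  trans (sum-allFin (λ u → sum (map (𝟙 ∘ F u) (allFin n)))) (ℕ-Sum.sum-cong-≗ λ u → sum-allFin (𝟙 ∘ F u))

length-arcs : ∀ {n} (F : ArcSet n) → length (arcs F) ≡ size F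
length-arcs F = begin
  length (arcs F)                              ≡⟨ length-flatten (λ u → collect (F u) (u ,_)) ⟩
  ∑ (λ u → length (collect (F u) (u ,_)))      ≡⟨ ℕ-Sum.sum-cong-≗ (λ u → length-collect (F u) (u ,_)) ⟩
  ∑ (λ u → count (F u))                        ≡⟨ size≡∑count F ⟨
  size F                                       ∎
  where open ≡-Reasoning

arcs-proper : ∀ {n} (F : ArcSet n) → (∀ u → F u u ≡ false) → All (uncurry _≢_) (arcs F)
arcs-proper F loopless =
  All-flatten (λ u → collect (F u) (u ,_)) λ u → All-collect (F u) (u ,_) λ { v Fuv refl → not-loop u Fuv }
  where
    not-loop : ∀ u → ¬ F u u ≡ true
    not-loop u Fuu with trans (sym (loopless u)) Fuu
    ... | ()

-- (a, a′, b′, b) = ([u = i], [v = i], [u = j], [v = j]) for i ≠ j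
pair-as-xor : ∀ a a′ b b′ → a ∧ b′ ≡ false → a′ ∧ b ≡ false →
              (a ∨ a′) ∧ (b′ ∨ b) ≡ (b ∧ a) xor (a′ ∧ b′)
pair-as-xor true  _     _     true  () _
pair-as-xor _     true  true  _     _  ()
pair-as-xor true  false b     false _  _ = sym (trans (xor-identityʳ (b ∧ true)) (∧-identityʳ b))
pair-as-xor true  true  false false _  _ = refl
pair-as-xor false false b     b′    _  _ = sym (trans (xor-identityʳ (b ∧ false)) (∧-zeroʳ b))
pair-as-xor false true  false b′    _  _ = ∨-identityʳ b′

⨁⨁-point : ∀ {n} (F : ArcSet n) a b →
           ⨁ (λ u → ⨁ (λ v → F u v ∧ ((v ≡ᵇ b) ∧ (u ≡ᵇ a)))) ≡ F a b
⨁⨁-point F a b =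
  trans (⊕-Sum.sum-cong-≗ λ u →
           trans (⊕-Sum.sum-cong-≗ λ v → trans (∧-comm (F u v) _) (∧-assoc (v ≡ᵇ b) (u ≡ᵇ a) (F u v)))
                 (⨁-point b λ v → (u ≡ᵇ a) ∧ F u v))
        (⨁-point a λ u → F u b)

flips-arcs : ∀ {n} (F : ArcSet n) → flips (arcs F) ≐ F ⊕ F ᵀ
flips-arcs {n} F i j i≢j = begin
  flips (arcs F) i j
    ≡⟨ parity-flatten h (λ u → collect (F u) (u ,_)) ⟩
  ⨁ (λ u → parity h (collect (F u) (u ,_)))
    ≡⟨ ⊕-Sum.sum-cong-≗ (λ u → parity-collect h (F u) (u ,_)) ⟩
  ⨁ (λ u → ⨁ (λ v → F u v ∧ pairRel u v i j))
    ≡⟨ ⊕-Sum.sum-cong-≗ (λ u → trans (⊕-Sum.sum-cong-≗ (split u)) (⊕-Sum.∑-distrib-+ (at i j u) (at j i u))) ⟩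
  ⨁ (λ u → ⨁ (at i j u) xor ⨁ (at j i u))
    ≡⟨ ⊕-Sum.∑-distrib-+ (⨁ ∘ at i j) (⨁ ∘ at j i) ⟩
  ⨁ (⨁ ∘ at i j) xor ⨁ (⨁ ∘ at j i)
    ≡⟨ cong₂ _xor_ (⨁⨁-point F i j) (⨁⨁-point F j i) ⟩
  F i j xor F j i ∎
  where
    open ≡-Reasoning
    h : Fin n × Fin n → Bool
    h e = uncurry pairRel e i j
    at : Fin n → Fin n → Fin n → Fin n → Bool
    at a b u v = F u v ∧ ((v ≡ᵇ b) ∧ (u ≡ᵇ a))
    split : ∀ u v → F u v ∧ pairRel u v i j ≡ at i j u v xor at j i u v
    split u v = trans (cong (F u v ∧_) (pair-as-xor (u ≡ᵇ i) (v ≡ᵇ i) (v ≡ᵇ j) (u ≡ᵇ j)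
                                                    (≡ᵇ-disjointˡ i≢j u) (≡ᵇ-disjointˡ i≢j v)))
                      (∧-distribˡ-xor (F u v) _ _)

infixr 5 _++ʷ_

_++ʷ_ : ∀ {n} {G : Digraph n} {a b c} → Walk G a b → Walk G b c → Walk G a c
[] ++ʷ w = w
(e ∷ w₁) ++ʷ w = e ∷ (w₁ ++ʷ w)

module AddedArc {n} {G H : Digraph n} {v u : Fin n}
                (H⊆G+vu : ∀ x y → Arc H x y → Arc G x y ⊎ (x ≡ v × y ≡ u)) where

  walk-split : ∀ {a b} → Walk H a b → Walk G a b ⊎ (Walk G a v × Walk H u b)
  walk-split [] = inj₁ []
  walk-split (e ∷ w) with H⊆G+vu _ _ e
  ... | inj₂ (refl , refl) = inj₂ ([] , w)
  ... | inj₁ g with walk-split w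
  ...   | inj₁ w′ = inj₁ (g ∷ w′)
  ...   | inj₂ (w₁ , w₂) = inj₂ (g ∷ w₁ , w₂)

  cycle⇒walk : Acyclic G → HasCycle H → Walk G u v
  cycle⇒walk acyclic (x , y , e , w) with H⊆G+vu x y e
  ... | inj₂ (refl , refl) with walk-split w
  ...   | inj₁ w′ = w′
  ...   | inj₂ (w₁ , _) = w₁
  cycle⇒walk acyclic (x , y , e , w) | inj₁ g with walk-split w
  ... | inj₁ w′ = ⊥-elim (acyclic (x , y , g , w′))
  ... | inj₂ (w₁ , w₂) with walk-split w₂
  ...   | inj₁ w₂′ = w₂′ ++ʷ (g ∷ w₁)
  ...   | inj₂ (w₃ , _) = w₃

𝟙-∧ : ∀ a b → 𝟙 (a ∧ b) ≤ 𝟙 a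
𝟙-∧ true true = ≤-refl
𝟙-∧ true false = z≤n
𝟙-∧ false b = ≤-refl

module MinimumFeedbackArcSet {n} {D : Digraph n} (oriented : Oriented D) {F : ArcSet n}
                             (F⊆D : IsArcSetOf F D) (acyclic : Acyclic (delete D F))
                             (minimum : ∀ F′ → FeedbackArcSet D F′ → size F ≤ size F′) where

  F-loopless : ∀ u → F u u ≡ false
  F-loopless u with F u u in Fuu
  ... | true = ⊥-elim (oriented u u (F⊆D u u Fuu) (F⊆D u u Fuu))
  ... | false = refl

  without : Fin n → Fin n → ArcSet n
  without v u x y = F x y ∧ not ((v ≡ᵇ x) ∧ (u ≡ᵇ y))

  without⊆D : ∀ {v u} → IsArcSetOf (without v u) D
  without⊆D x y e with F x y in Fxy
  ... | true = F⊆D x y Fxy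

  size-without : ∀ {v u} → F v u ≡ true → size (without v u) < size F
  size-without {v} {u} Fvu rewrite size≡∑count (without v u) | size≡∑count F =
    ∑-mono-< (λ x → ∑-mono-≤ λ y → 𝟙-∧ (F x y) _) v (∑-mono-< (λ y → 𝟙-∧ (F v y) _) u strict)
    where
      strict : 𝟙 (without v u v u) < 𝟙 (F v u)
      strict rewrite ≡ᵇ-refl v | ≡ᵇ-refl u | Fvu = s≤s z≤n

  without-arcs : ∀ {v u} x y → Arc (delete D (without v u)) x y → Arc (delete D F) x y ⊎ (x ≡ v × y ≡ u)
  without-arcs {v} {u} x y e with D x y | F x y | v ≟ x | u ≟ y
  ... | true | false | _ | _ = inj₁ refl
  ... | true | true | yes refl | yes refl = inj₂ (refl , refl)
  without-arcs x y () | true | true | yes _ | no _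
  without-arcs x y () | true | true | no _ | _
  without-arcs x y () | false | _ | _ | _

  -- By minimality F − vu is no feedback arc set, and every cycle of D − (F − vu) uses vu.
  path-back : ∀ {v u} → F v u ≡ true → ¬ ¬ Walk (delete D F) u v
  path-back {v} {u} Fvu no-path =
    <⇒≱ (size-without Fvu)
        (minimum (without v u)
                 (without⊆D {v} {u} , λ cycle → no-path (AddedArc.cycle⇒walk without-arcs acyclic cycle)))

  reversed : Digraph n
  reversed = reverseOn (F ⊕ F ᵀ) D

  reversed-arc : ∀ {x y} → Arc reversed x y → Arc (delete D F) x y ⊎ F y x ≡ true
  reversed-arc {x} {y} e with F x y in Fxy | F y x in Fyx
  ... | true | true = ⊥-elim (oriented x y (F⊆D x y Fxy) (F⊆D y x Fyx))
  ... | true | false = ⊥-elim (oriented x y (F⊆D x y Fxy) e)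
  ... | false | true = inj₂ refl
  ... | false | false = inj₁ (trans (∧-identityʳ (D x y)) e)

  walk-lift : ∀ {a b} → Walk reversed a b → ¬ ¬ Walk (delete D F) a b
  walk-lift [] k = k []
  walk-lift (e ∷ w) k with reversed-arc e
  ... | inj₁ g = walk-lift w (k ∘ (g ∷_))
  ... | inj₂ Fca = path-back Fca λ back → walk-lift w (k ∘ (back ++ʷ_))

  reversed-acyclic : Acyclic reversed
  reversed-acyclic (x , y , e , w) = walk-lift (e ∷ []) λ wxy → walk-lift w λ wyx → close e wxy wyx
    where
      close : ∀ {y} → Arc reversed x y → Walk (delete D F) x y → Walk (delete D F) y x → ⊥
      close e [] _ = let loop = trans (sym (if-eta ((F ⊕ F ᵀ) x x))) e in oriented x x loop loop
      close _ (g ∷ w₁) wyx = acyclic (x , _ , g , w₁ ++ʷ wyx)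

another-vertex : ∀ {n} → 2 ≤ n → (a : Fin n) → Σ[ x ∈ Fin n ] ¬ x ≡ a
another-vertex (s≤s (s≤s _)) zero = suc zero , λ ()
another-vertex (s≤s (s≤s _)) (suc _) = zero , λ ()

module _ {n} {G : Digraph n} (acyclic : Acyclic G) where

  no-infinite-descent : (s : ℕ → Fin n) → ¬ (∀ k → Arc G (s (suc k)) (s k))
  no-infinite-descent s descent with pigeonhole (n<1+n n) (s ∘ toℕ)
  ... | i , j , i<j , sᵢ≡sⱼ =
    acyclic (s (suc (d + toℕ i)) , s (d + toℕ i) , descent (d + toℕ i) ,
             subst (Walk G (s (d + toℕ i))) (trans sᵢ≡sⱼ (cong s j≡)) (walk-down d))
    where
      d = toℕ j ∸ suc (toℕ i)
      j≡ : toℕ j ≡ suc (d + toℕ i)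
      j≡ = trans (sym (m∸n+n≡m i<j)) (+-suc d (toℕ i))
      walk-down : ∀ e → Walk G (s (e + toℕ i)) (s (toℕ i))
      walk-down zero = []
      walk-down (suc e) = descent (e + toℕ i) ∷ walk-down e

  in-neighbour? : ∀ {P : Fin n → Set} → Decidable P → ∀ s → Dec (Σ[ x ∈ Fin n ] P x × Arc G x s)
  in-neighbour? P? s = any? λ x → P? x ×-dec (G x s ≟ᵇ true)

  source : ∀ {P : Fin n → Set} → Decidable P → Σ (Fin n) P →
           Σ[ s ∈ Fin n ] P s × (∀ x → P x → ¬ Arc G x s)
  source {P} P? (s₀ , Ps₀) with any? (λ s → P? s ×-dec ¬? (in-neighbour? P? s))
  ... | yes (s , Ps , none) = s , Ps , λ x Px e → none (x , Px , e)
  ... | no no-source = ⊥-elim (no-infinite-descent (proj₁ ∘ chain) (proj₂ ∘ proj₂ ∘ step ∘ chain))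
    where
      step : (s : Σ (Fin n) P) → Σ[ x ∈ Fin n ] P x × Arc G x (proj₁ s)
      step (s , Ps) = decidable-stable (in-neighbour? P? s) λ none → no-source (s , Ps , none)
      chain : ℕ → Σ (Fin n) P
      chain zero = s₀ , Ps₀
      chain (suc k) = proj₁ (step (chain k)) , proj₁ (proj₂ (step (chain k)))

  two-sources : 2 ≤ n → Σ[ a ∈ Fin n ] Σ[ b ∈ Fin n ]
                ¬ a ≡ b × (∀ x → ¬ Arc G x a) × (∀ x → ¬ x ≡ a → ¬ Arc G x b)
  two-sources 2≤n with source {P = λ _ → ⊤} (λ _ → yes tt) (fromℕ< (≤-trans (s≤s z≤n) 2≤n) , tt)
  ... | a , _ , a-source with source (λ x → ¬? (x ≟ a)) (another-vertex 2≤n a)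
  ...   | b , b≢a , b-source = a , b , b≢a ∘ sym , (λ x → a-source x tt) , b-source

module ReverseSources {n} {H : Digraph n} (acyclic : Acyclic H) {a b : Fin n} (a≢b : ¬ a ≡ b)
                      (a-source : ∀ x → ¬ Arc H x a) (b-source : ∀ x → ¬ x ≡ a → ¬ Arc H x b) where

  E : Digraph n
  E = reverseOn (pairRel a b) H

  data Position (x : Fin n) : Set where
    at-a : x ≡ a → Position x
    at-b : x ≡ b → Position x
    outside : ⁅ a , b ⁆ x ≡ false → ¬ x ≡ a → Position x

  position : ∀ x → Position x
  position x with a ≟ x | b ≟ x
  ... | yes refl | _ = at-a refl
  ... | no _ | yes refl = at-b refl
  ... | no a≢x | no b≢x = outside (cong₂ _∨_ (≢⇒≢ᵇ a≢x) (≢⇒≢ᵇ b≢x)) (a≢x ∘ sym)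

  a∈ab : ⁅ a , b ⁆ a ≡ true
  a∈ab = cong (_∨ (b ≡ᵇ a)) (≡ᵇ-refl a)

  b∈ab : ⁅ a , b ⁆ b ≡ true
  b∈ab = trans (cong ((a ≡ᵇ b) ∨_) (≡ᵇ-refl b)) (∨-zeroʳ (a ≡ᵇ b))

  E-inside : ∀ {x y} → ⁅ a , b ⁆ x ≡ true → ⁅ a , b ⁆ y ≡ true → E x y ≡ H y x
  E-inside {x} {y} x∈ y∈ = cong (if_then H y x else H x y) (cong₂ _∧_ x∈ y∈)

  E-outside : ∀ {x y} → ⁅ a , b ⁆ x ≡ false ⊎ ⁅ a , b ⁆ y ≡ false → E x y ≡ H x y
  E-outside {x} {y} (inj₁ x∉) = cong (if_then H y x else H x y) (cong (_∧ ⁅ a , b ⁆ y) x∉)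
  E-outside {x} {y} (inj₂ y∉) =
    cong (if_then H y x else H x y) (trans (cong (⁅ a , b ⁆ x ∧_) y∉) (∧-zeroʳ (⁅ a , b ⁆ x)))

  into-b : ∀ x → ¬ Arc E x b
  into-b x e with position x
  ... | at-a refl = a-source b (trans (sym (E-inside a∈ab b∈ab)) e)
  ... | at-b refl = b-source b (a≢b ∘ sym) (trans (sym (E-inside b∈ab b∈ab)) e)
  ... | outside x∉ x≢a = b-source x x≢a (trans (sym (E-outside (inj₁ x∉))) e)

  into-a : ∀ x → Arc E x a → x ≡ b
  into-a x e with position x
  ... | at-a refl = ⊥-elim (a-source a (trans (sym (E-inside a∈ab a∈ab)) e))
  ... | at-b refl = refl
  ... | outside x∉ _ = ⊥-elim (a-source x (trans (sym (E-outside (inj₁ x∉))) e))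

  walk-into-b : ∀ {s} → Walk E s b → s ≡ b
  walk-into-b [] = refl
  walk-into-b {s} (e ∷ w) with walk-into-b w
  ... | refl = ⊥-elim (into-b s e)

  walk-outside : ∀ {y z} → ⁅ a , b ⁆ y ≡ false → Walk E y z → Walk H y z × ⁅ a , b ⁆ z ≡ false
  walk-outside y∉ [] = [] , y∉
  walk-outside {y} y∉ (_∷_ {y = c} e w) with position c
  ... | at-a refl with into-a y e
  ...   | refl with trans (sym b∈ab) y∉
  ...     | ()
  walk-outside {y} y∉ (_∷_ {y = c} e w) | at-b refl = ⊥-elim (into-b y e)
  walk-outside {y} y∉ (_∷_ {y = c} e w) | outside c∉ _ with walk-outside c∉ w
  ... | w′ , z∉ = trans (sym (E-outside (inj₁ y∉))) e ∷ w′ , z∉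

  -- In E the vertex b is a source and a's only in-neighbour is b, so a cycle avoids both.
  E-acyclic : Acyclic E
  E-acyclic (x , y , e , w) with position y
  ... | at-a refl with into-a x e
  ...   | refl = a≢b (walk-into-b w)
  E-acyclic (x , y , e , w) | at-b refl = into-b x e
  E-acyclic (x , y , e , w) | outside y∉ _ =
    acyclic (x , y , trans (sym (E-outside (inj₂ y∉))) e , proj₁ (walk-outside y∉ w))

module _ {n p : ℕ} (1≤p : 1 ≤ p) (p-even : 2 ∣ p) (room : p + 2 ≤ n)
         {D : Digraph n} (oriented : Oriented D) {F : ArcSet n} (F⊆D : IsArcSetOf F D)
         (F-feedback : Acyclic (delete D F)) (minimum : ∀ F′ → FeedbackArcSet D F′ → size F ≤ size F′) where

  open MinimumFeedbackArcSet oriented F⊆D F-feedback minimum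
  open PairReversal 1≤p p-even room

  private
    bound : (2 * p ∸ 2) * (length (arcs F) + 1) ≤ (2 * p ∸ 2) * (size F + 1)
    bound = ≤-reflexive (cong (λ l → (2 * p ∸ 2) * (l + 1)) (length-arcs F))

    flips-arcs-⊕ : ∀ ψ → flips (arcs F) ⊕ ψ ≐ F ⊕ F ᵀ ⊕ ψ
    flips-arcs-⊕ ψ i j i≢j = cong (_xor ψ i j) (flips-arcs F i j i≢j)

    reverseOn-reversed : ∀ ψ x y → reverseOn (F ⊕ F ᵀ ⊕ ψ) D x y ≡ reverseOn ψ reversed x y
    reverseOn-reversed ψ x y = sym (reverseOn-⊕ {φ = F ⊕ F ᵀ} {ψ} {D} (λ u v → xor-comm (F v u) (F u v)) x y)

  inversions-from-minimum-fas : InvEqLe p D ((2 * p ∸ 2) * (size F + 1))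
  inversions-from-minimum-fas with two-sources reversed-acyclic (≤-trans (m≤n+m 2 p) room)
  ... | a , b , a≢b , a-source , b-source with even-pairs-with-spare (arcs-proper F F-loopless) a≢b
  ... | inj₁ r = Realises⇒InvEqLe (Realises-weaken bound (Realises-cong (flips-arcs F) r)) reversed-acyclic
  ... | inj₂ r =
    Realises⇒InvEqLe (Realises-weaken bound (Realises-cong (flips-arcs-⊕ (pairRel a b)) r))
                     (acyclic-≗ (reverseOn-reversed (pairRel a b))
                                (ReverseSources.E-acyclic reversed-acyclic a≢b a-source b-source))

theorem4p3 : (p : ℕ) → 4 ≤ p → 2 ∣ p →
    (n : ℕ) → p + 2 ≤ n →
    (D : Digraph n) → Oriented D →
    (f : ℕ) → IsFas D f →
    InvEqLe p D ((2 * p ∸ 2) * (f + 1))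
theorem4p3 p 4≤p p-even n room D oriented f ((F , (F⊆D , F-feedback) , size≡f) , minimum) =
  subst (λ k → InvEqLe p D ((2 * p ∸ 2) * (k + 1))) size≡f
    (inversions-from-minimum-fas (≤-trans (s≤s z≤n) 4≤p) p-even room oriented F⊆D F-feedback
       (λ F′ fas → subst (_≤ size F′) (sym size≡f) (minimum F′ fas)))
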